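{- Let $1\le s\le d/2$, $n\ge d+1$, and let $\mathcal F\subseteq\binom{[n]}{d+1}$ be an $s$-witness family with fixed witnesses $B_F$ ($F\in\mathcal F$), and $\mathcal B=\{B_F:F\in\mathcal F\}$. Suppose that for each $B\in\mathcal B$ we are given a family $\mathcal A_B$ of subsets of $[n]\setminus B$ of size at most $d+1-s$ that is intersecting, such that every $F\in\mathcal F$ with $B_F=B$ contains some $A\in\mathcal A_B$, and such that every $F\in\mathcal F$ with $B\subseteq F$ satisfies $A\cap F\ne\varnothing$ for all $A\in\mathcal A_B$. Let $\mathcal B_1$ be the set of $B\in\mathcal B$ such that $\mathcal A_B$ contains a singleton $\{x_B\}$; for $B\in\mathcal B_1$ set $\mathcal F_B=\{F\in\mathcal F: B\cup\{x_B\}\subseteq F\}$, and let $\mathcal F_1=\bigcup_{B\in\mathcal B_1}\mathcal F_B$. For $B,B'\in\mathcal B_1$ let $\mathcal U(B,B')=\{E\in\binom{[n]}{d}: B\cup B'\subseteq E,\ x_B,x_{B'}\notin E\}$, let $\mathcal P=\{(B,B')\in\mathcal B_1\times\mathcal B_1: x_B\ne x_{B'},\ x_B\notin B',\ x_{B'}\notin B\}$, and $\mathcal U=\bigcup_{(B,B')\in\mathcal P}\mathcal U(B,B')$. Then $$|\mathcal F_1|+|\mathcal U|\le\binom{n}{d}.$$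
   Context: $[n]=\{1,\dots,n\}$, $\binom{X}{k}$ is the family of $k$-subsets of $X$. A family $\mathcal F\subseteq\binom{[n]}{d+1}$ is an $s$-witness family if for every $F\in\mathcal F$ there exists $B_F\subseteq F$ with $|B_F|=s$ such that $F\cap F'\neq B_F$ for every $F'\in\mathcal F$; here one such $B_F$ is fixed for each $F$. Since $\mathcal A_B$ is intersecting, at most one singleton lies in $\mathcal A_B$, so $x_B$ is well defined. -}

module Defs where

open import Data.Nat using (ℕ; suc; _+_; _≤_; _∸_)
open import Data.Fin using (Fin)
open import Data.Fin.Subset using (Subset; _∈_; _∉_; _⊆_; _∩_; _∪_; ∣_∣; ⁅_⁆; Nonempty)
open import Data.List using (List; length)
open import Data.List.Relation.Unary.All using (All)
open import Data.List.Relation.Unary.Unique.Propositional using (Unique)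
open import Data.Product using (_×_; ∃; ∃-syntax)
open import Relation.Binary.PropositionalEquality using (_≡_; _≢_)

Family : ℕ → Set₁
Family n = Subset n → Set

UniformFamily : {n : ℕ} → ℕ → Family n → Set
UniformFamily k 𝓕 = ∀ F → 𝓕 F → ∣ F ∣ ≡ k

IsWitnessFamily : {n : ℕ} → (s : ℕ) → (𝓕 : Family n) → (BF : Subset n → Subset n) → Set
IsWitnessFamily s 𝓕 BF =
  ∀ F → 𝓕 F →
    (BF F ⊆ F) × (∣ BF F ∣ ≡ s) × (∀ F′ → 𝓕 F′ → F ∩ F′ ≢ BF F)

WitnessSets : {n : ℕ} → Family n → (Subset n → Subset n) → Family n
WitnessSets 𝓕 BF B = ∃[ F ] (𝓕 F × BF F ≡ B)

Intersecting : {n : ℕ} → Family n → Set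
Intersecting 𝓐 = ∀ A A′ → 𝓐 A → 𝓐 A′ → Nonempty (A ∩ A′)

GoodAFamilies : {n : ℕ} → (d s : ℕ) → (𝓕 : Family n) → (BF : Subset n → Subset n)
              → (𝓐 : Subset n → Family n) → Set
GoodAFamilies d s 𝓕 BF 𝓐 =
  ∀ B → WitnessSets 𝓕 BF B →
    (∀ A → 𝓐 B A → (∀ x → x ∈ A → x ∉ B) × (∣ A ∣ ≤ suc d ∸ s)) ×
    Intersecting (𝓐 B) ×
    (∀ F → 𝓕 F → BF F ≡ B → ∃[ A ] (𝓐 B A × A ⊆ F)) ×
    (∀ F → 𝓕 F → B ⊆ F → ∀ A → 𝓐 B A → Nonempty (A ∩ F))

-- "B ∈ 𝓑₁ and x = x_B": B ∈ 𝓑 and {x} ∈ 𝓐_B (x_B is unique since 𝓐_B is intersecting).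
HasSingleton : {n : ℕ} → (𝓕 : Family n) → (BF : Subset n → Subset n)
             → (𝓐 : Subset n → Family n) → Subset n → Fin n → Set
HasSingleton 𝓕 BF 𝓐 B x = WitnessSets 𝓕 BF B × 𝓐 B ⁅ x ⁆

F₁ : {n : ℕ} → (𝓕 : Family n) → (BF : Subset n → Subset n)
   → (𝓐 : Subset n → Family n) → Family n
F₁ 𝓕 BF 𝓐 F = 𝓕 F × ∃[ B ] ∃[ x ] (HasSingleton 𝓕 BF 𝓐 B x × B ∪ ⁅ x ⁆ ⊆ F)

U : {n : ℕ} → (d : ℕ) → (𝓕 : Family n) → (BF : Subset n → Subset n)
  → (𝓐 : Subset n → Family n) → Family n
U d 𝓕 BF 𝓐 E =
  ∃[ B ] ∃[ B′ ] ∃[ x ] ∃[ x′ ]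
    ( HasSingleton 𝓕 BF 𝓐 B x × HasSingleton 𝓕 BF 𝓐 B′ x′
    × x ≢ x′ × x ∉ B′ × x′ ∉ B
    × ∣ E ∣ ≡ d × B ∪ B′ ⊆ E × x ∉ E × x′ ∉ E )

-- |𝓟| + |𝓠| ≤ k for families of subsets of the finite set [n]:
-- any duplicate-free lists of members of 𝓟 and of 𝓠 have total length ≤ k.
CardSum≤ : {n : ℕ} → Family n → Family n → ℕ → Set
CardSum≤ {n} 𝓟 𝓠 k =
  ∀ (L M : List (Subset n)) → Unique L → Unique M → All 𝓟 L → All 𝓠 M →
    length L + length M ≤ k

{-# OPTIONS --safe #-}
-- For F ∈ 𝓕₁, coming from B ∈ 𝓑₁, send F to the d-set F ∖ {x_B}. The removed point can be
-- read off the image: x_B ∉ B, so B ⊆ F ∖ {x_B}; and whenever some B′ ∈ 𝓑₁ lies in F ∖ {x}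
-- while x_{B′} does not, x_{B′} = x, because {x_{B′}} ∈ 𝓐_{B′} must meet F ⊇ B′. Hence
-- F ↦ F ∖ {x_B} is injective, and it misses 𝓤: a member E of 𝓤 would force both of its
-- distinct points x_B, x_{B′} to be the point removed to get E. So 𝓕₁ and 𝓤 inject jointly
-- into the d-subsets of [n].
module Submission where

open import Defs
open import Data.Nat using (ℕ; zero; suc; _≤_; _*_; _+_; z≤n; s≤s)
open import Data.Nat.Properties using (+-mono-≤; suc-injective; +-suc; module ≤-Reasoning)
open import Data.Nat.Combinatorics using (_C_; nCk+nC[k+1]≡[n+1]C[k+1])
open import Data.Fin using (Fin; zero; suc)
open import Data.Fin.Properties using (_≟_)
open import Data.Fin.Subset
  using (Side; inside; outside; Subset; _∈_; _∉_; _⊆_; _∪_; ∣_∣; ⁅_⁆; _-_; ⊥)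
open import Data.Fin.Subset.Properties
  using (x∈⁅x⁆; x∈⁅y⁆⇒x≡y; x∈p∩q⁻; p⊆p∪q; q⊆p∪q; x∈p∧x≢y⇒x∈p-y; p─q⊆p; ⊆-antisym; p─⊥≡p; drop-there)
open import Data.Vec using ([]; _∷_; here; there)
open import Data.List using (List; []; _∷_; length; _++_)
open import Data.List.Properties using (length-++)
open import Data.List.Relation.Unary.All using (All; []; _∷_; reduce)
import Data.List.Relation.Unary.All as All
import Data.List.Relation.Unary.All.Properties as All
open import Data.List.Relation.Unary.AllPairs using ([]; _∷_)
open import Data.List.Relation.Unary.Unique.Propositional using (Unique)
import Data.List.Relation.Unary.Unique.Propositional.Properties as Unique
open import Data.Product using (_,_)
open import Function using (_∘_)
open import Relation.Nullary using (¬_; contradiction)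
open import Relation.Nullary.Decidable using (yes; no; decidable-stable)
open import Relation.Binary.PropositionalEquality
  using (_≡_; _≢_; refl; sym; trans; cong; subst)

private
  variable
    n : ℕ
    x y : Fin n
    p q : Subset n

module _ {a b p} {A : Set a} {B : Set b} {P : A → Set p} (f : ∀ {x} → P x → B) where

  length-reduce : ∀ {xs} (pxs : All P xs) → length (reduce f pxs) ≡ length xs
  length-reduce []        = refl
  length-reduce (_ ∷ pxs) = cong suc (length-reduce pxs)

  reduce⁺ : ∀ {q} {Q : B → Set q} → (∀ {x} (px : P x) → Q (f px)) →
            ∀ {xs} (pxs : All P xs) → All Q (reduce f pxs)
  reduce⁺ Qf []         = []
  reduce⁺ Qf (px ∷ pxs) = Qf px ∷ reduce⁺ Qf pxs

  reduce-unique : (∀ {x y} (px : P x) (py : P y) → f px ≡ f py → x ≡ y) →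
                  ∀ {xs} (pxs : All P xs) → Unique xs → Unique (reduce f pxs)
  reduce-unique inj []         []            = []
  reduce-unique inj (px ∷ pxs) (x≢xs ∷ uniq) = distinct px pxs x≢xs ∷ reduce-unique inj pxs uniq
    where
    distinct : ∀ {x ys} (px : P x) (pys : All P ys) → All (x ≢_) ys → All (f px ≢_) (reduce f pys)
    distinct px []         []            = []
    distinct px (py ∷ pys) (x≢y ∷ x≢ys) = x≢y ∘ inj px py ∷ distinct px pys x≢ys

length≤1 : ∀ {a} {A : Set a} {x : A} {xs : List A} → Unique xs → All (_≡ x) xs → length xs ≤ 1
length≤1 {xs = []}        _                 _                 = z≤n
length≤1 {xs = _ ∷ []}    _                 _                 = s≤s z≤n
length≤1 {xs = _ ∷ _ ∷ _} ((y≢z ∷ _) ∷ _) (refl ∷ z≡x ∷ _) = contradiction (sym z≡x) y≢z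

∣p∣≡0⇒p≡⊥ : ∣ p ∣ ≡ 0 → p ≡ ⊥
∣p∣≡0⇒p≡⊥ {p = []}          _      = refl
∣p∣≡0⇒p≡⊥ {p = outside ∷ p} ∣p∣≡0 = cong (outside ∷_) (∣p∣≡0⇒p≡⊥ ∣p∣≡0)

tailsWith : Side → List (Subset (suc n)) → List (Subset n)
tailsWith _       []                   = []
tailsWith inside  ((inside  ∷ p) ∷ ps) = p ∷ tailsWith inside ps
tailsWith outside ((outside ∷ p) ∷ ps) = p ∷ tailsWith outside ps
tailsWith inside  ((outside ∷ _) ∷ ps) = tailsWith inside ps
tailsWith outside ((inside  ∷ _) ∷ ps) = tailsWith outside ps

tailsWith⁺ : ∀ {ℓ} {P : Subset (suc n) → Set ℓ} b {ps} →
             All P ps → All (P ∘ (b ∷_)) (tailsWith b ps)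
tailsWith⁺ _       {[]}                []         = []
tailsWith⁺ inside  {(inside  ∷ _) ∷ _} (Pp ∷ Pps) = Pp ∷ tailsWith⁺ inside Pps
tailsWith⁺ outside {(outside ∷ _) ∷ _} (Pp ∷ Pps) = Pp ∷ tailsWith⁺ outside Pps
tailsWith⁺ inside  {(outside ∷ _) ∷ _} (_  ∷ Pps) = tailsWith⁺ inside Pps
tailsWith⁺ outside {(inside  ∷ _) ∷ _} (_  ∷ Pps) = tailsWith⁺ outside Pps

tailsWith-unique : ∀ b {ps : List (Subset (suc n))} → Unique ps → Unique (tailsWith b ps)
tailsWith-unique _       {[]}                []            = []
tailsWith-unique inside  {(inside  ∷ _) ∷ _} (p≢ps ∷ uniq) =
  All.map (_∘ cong (inside ∷_)) (tailsWith⁺ inside p≢ps) ∷ tailsWith-unique inside uniq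
tailsWith-unique outside {(outside ∷ _) ∷ _} (p≢ps ∷ uniq) =
  All.map (_∘ cong (outside ∷_)) (tailsWith⁺ outside p≢ps) ∷ tailsWith-unique outside uniq
tailsWith-unique inside  {(outside ∷ _) ∷ _} (_ ∷ uniq)     = tailsWith-unique inside uniq
tailsWith-unique outside {(inside  ∷ _) ∷ _} (_ ∷ uniq)     = tailsWith-unique outside uniq

length-tailsWith : (ps : List (Subset (suc n))) →
                   length ps ≡ length (tailsWith inside ps) + length (tailsWith outside ps)
length-tailsWith []                   = refl
length-tailsWith ((inside  ∷ _) ∷ ps) = cong suc (length-tailsWith ps)
length-tailsWith ((outside ∷ _) ∷ ps) =
  trans (cong suc (length-tailsWith ps)) (sym (+-suc _ (length (tailsWith outside ps))))

-- Split the k-sets by whether they contain the first point; Pascal's rule adds the two bounds.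
length≤C : ∀ n k {ps : List (Subset n)} → Unique ps → All (λ p → ∣ p ∣ ≡ k) ps → length ps ≤ n C k
length≤C n       zero    uniq sizes = length≤1 uniq (All.map ∣p∣≡0⇒p≡⊥ sizes)
length≤C zero    (suc k) {[]}     _ []       = z≤n
length≤C zero    (suc k) {[] ∷ _} _ (() ∷ _)
length≤C (suc n) (suc k) {ps} uniq sizes = begin
  length ps
    ≡⟨ length-tailsWith ps ⟩
  length (tailsWith inside ps) + length (tailsWith outside ps)
    ≤⟨ +-mono-≤ (length≤C n k (tailsWith-unique inside uniq)
                             (All.map suc-injective (tailsWith⁺ inside sizes)))
                (length≤C n (suc k) (tailsWith-unique outside uniq) (tailsWith⁺ outside sizes)) ⟩
  n C k + n C suc k
    ≡⟨ nCk+nC[k+1]≡[n+1]C[k+1] n k ⟩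
  suc n C suc k ∎
  where open ≤-Reasoning

x∉p-x : ∀ (p : Subset n) x → x ∉ p - x
x∉p-x (_ ∷ p) zero    ()
x∉p-x (_ ∷ p) (suc x) x∈p-x = x∉p-x p x (drop-there x∈p-x)

x∈p∧x∉p-y⇒x≡y : x ∈ p → x ∉ p - y → x ≡ y
x∈p∧x∉p-y⇒x≡y x∈p x∉p-y = decidable-stable (_ ≟ _) (x∉p-y ∘ x∈p∧x≢y⇒x∈p-y x∈p)

x∈p⇒suc∣p-x∣≡∣p∣ : x ∈ p → suc ∣ p - x ∣ ≡ ∣ p ∣
x∈p⇒suc∣p-x∣≡∣p∣ {p = inside  ∷ p} here        = cong (suc ∘ ∣_∣) (p─⊥≡p p)
x∈p⇒suc∣p-x∣≡∣p∣ {p = inside  ∷ p} (there x∈p) = cong suc (x∈p⇒suc∣p-x∣≡∣p∣ x∈p)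
x∈p⇒suc∣p-x∣≡∣p∣ {p = outside ∷ p} (there x∈p) = x∈p⇒suc∣p-x∣≡∣p∣ x∈p

p⊆q∧x∉p⇒p⊆q-x : p ⊆ q → x ∉ p → p ⊆ q - x
p⊆q∧x∉p⇒p⊆q-x p⊆q x∉p y∈p = x∈p∧x≢y⇒x∈p-y (p⊆q y∈p) λ { refl → x∉p y∈p }

p-x≡q-x⇒p⊆q : x ∈ q → p - x ≡ q - x → p ⊆ q
p-x≡q-x⇒p⊆q {x = x} {q = q} x∈q p-x≡q-x {y} y∈p with y ≟ x
... | yes refl = x∈q
... | no  y≢x  = p─q⊆p q ⁅ x ⁆ (subst (y ∈_) p-x≡q-x (x∈p∧x≢y⇒x∈p-y y∈p y≢x))

p-x≡q-x⇒p≡q : x ∈ p → x ∈ q → p - x ≡ q - x → p ≡ q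
p-x≡q-x⇒p≡q x∈p x∈q p-x≡q-x = ⊆-antisym (p-x≡q-x⇒p⊆q x∈q p-x≡q-x) (p-x≡q-x⇒p⊆q x∈p (sym p-x≡q-x))

p∪⁅x⁆⊆q⇒x∈q : p ∪ ⁅ x ⁆ ⊆ q → x ∈ q
p∪⁅x⁆⊆q⇒x∈q {p = p} {x = x} p∪x⊆q = p∪x⊆q (q⊆p∪q p ⁅ x ⁆ (x∈⁅x⁆ x))

module Shadow {d s : ℕ} {𝓕 : Family n} {BF : Subset n → Subset n} {𝓐 : Subset n → Family n}
              (good : GoodAFamilies d s 𝓕 BF 𝓐) where

  singleton∉witness : ∀ {B} → HasSingleton 𝓕 BF 𝓐 B x → x ∉ B
  singleton∉witness {x = x} {B} (B∈𝓑 , ⁅x⁆∈𝓐) =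
    let bounded , _ = good B B∈𝓑
        avoidsB , _ = bounded ⁅ x ⁆ ⁅x⁆∈𝓐
    in avoidsB x (x∈⁅x⁆ x)

  singleton∈superset : ∀ {B F} → HasSingleton 𝓕 BF 𝓐 B x → 𝓕 F → B ⊆ F → x ∈ F
  singleton∈superset {x = x} {B} {F} (B∈𝓑 , ⁅x⁆∈𝓐) F∈𝓕 B⊆F =
    let _ , _ , _ , meets = good B B∈𝓑
        y , y∈⁅x⁆∩F       = meets F F∈𝓕 B⊆F ⁅ x ⁆ ⁅x⁆∈𝓐
        y∈⁅x⁆ , y∈F       = x∈p∩q⁻ ⁅ x ⁆ F y∈⁅x⁆∩F
    in subst (_∈ F) (x∈⁅y⁆⇒x≡y x y∈⁅x⁆) y∈F

  singleton≡removed : ∀ {B F} → HasSingleton 𝓕 BF 𝓐 B y → 𝓕 F → B ⊆ F - x → y ∉ F - x → y ≡ x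
  singleton≡removed {x = x} {F = F} hasY F∈𝓕 B⊆F-x =
    x∈p∧x∉p-y⇒x≡y (singleton∈superset hasY F∈𝓕 (p─q⊆p F ⁅ x ⁆ ∘ B⊆F-x))

  shadow : ∀ {F} → F₁ 𝓕 BF 𝓐 F → Subset n
  shadow {F} (_ , _ , x , _) = F - x

  shadow-injective : ∀ {F F′} (F∈𝓕₁ : F₁ 𝓕 BF 𝓐 F) (F′∈𝓕₁ : F₁ 𝓕 BF 𝓐 F′) →
                     shadow F∈𝓕₁ ≡ shadow F′∈𝓕₁ → F ≡ F′
  shadow-injective {F} {F′} (_ , B , x , hasX , B∪x⊆F) (F′∈𝓕 , _ , x′ , _ , B′∪x′⊆F′) F-x≡F′-x′ =
    p-x≡q-x⇒p≡q (p∪⁅x⁆⊆q⇒x∈q B∪x⊆F) (subst (_∈ F′) (sym x≡x′) (p∪⁅x⁆⊆q⇒x∈q B′∪x′⊆F′))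
                (trans F-x≡F′-x′ (cong (F′ -_) (sym x≡x′)))
    where
    x≡x′ : x ≡ x′
    x≡x′ = singleton≡removed hasX F′∈𝓕
      (subst (B ⊆_) F-x≡F′-x′ (p⊆q∧x∉p⇒p⊆q-x (B∪x⊆F ∘ p⊆p∪q ⁅ x ⁆) (singleton∉witness hasX)))
      (subst (x ∉_) F-x≡F′-x′ (x∉p-x F x))

  shadow∉U : ∀ {F} (F∈𝓕₁ : F₁ 𝓕 BF 𝓐 F) → ¬ U d 𝓕 BF 𝓐 (shadow F∈𝓕₁)
  shadow∉U (F∈𝓕 , _) (B₁ , B₂ , _ , _ , hasX₁ , hasX₂ , x₁≢x₂ , _ , _ , _ , B₁∪B₂⊆E , x₁∉E , x₂∉E) =
    x₁≢x₂ (trans (singleton≡removed hasX₁ F∈𝓕 (B₁∪B₂⊆E ∘ p⊆p∪q B₂) x₁∉E)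
             (sym (singleton≡removed hasX₂ F∈𝓕 (B₁∪B₂⊆E ∘ q⊆p∪q B₁ B₂) x₂∉E)))

  ∣shadow∣≡d : UniformFamily (suc d) 𝓕 → ∀ {F} (F∈𝓕₁ : F₁ 𝓕 BF 𝓐 F) → ∣ shadow F∈𝓕₁ ∣ ≡ d
  ∣shadow∣≡d uniform {F} (F∈𝓕 , _ , _ , _ , B∪x⊆F) =
    suc-injective (trans (x∈p⇒suc∣p-x∣≡∣p∣ (p∪⁅x⁆⊆q⇒x∈q B∪x⊆F)) (uniform F F∈𝓕))

corollary2p5 : (n d s : ℕ) → 1 ≤ s → 2 * s ≤ d → suc d ≤ n
    → (𝓕 : Family n) → UniformFamily (suc d) 𝓕
    → (BF : Subset n → Subset n) → IsWitnessFamily s 𝓕 BF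
    → (𝓐 : Subset n → Family n) → GoodAFamilies d s 𝓕 BF 𝓐
    → CardSum≤ (F₁ 𝓕 BF 𝓐) (U d 𝓕 BF 𝓐) (n C d)
corollary2p5 n d s _ _ _ 𝓕 uniform BF _ 𝓐 good L M uniqL uniqM L⊆𝓕₁ M⊆𝓤 = begin
  length L + length M  ≡⟨ cong (_+ length M) (sym (length-reduce shadow L⊆𝓕₁)) ⟩
  length S + length M  ≡⟨ sym (length-++ S) ⟩
  length (S ++ M)      ≤⟨ length≤C n d uniq sizes ⟩
  n C d                ∎
  where
  open ≤-Reasoning
  open Shadow {d = d} {s = s} good
  S : List (Subset n)
  S = reduce shadow L⊆𝓕₁
  S∩𝓤≡∅ : All (¬_ ∘ U d 𝓕 BF 𝓐) S
  S∩𝓤≡∅ = reduce⁺ shadow shadow∉U L⊆𝓕₁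
  uniq : Unique (S ++ M)
  uniq = Unique.++⁺ (reduce-unique shadow shadow-injective L⊆𝓕₁ uniqL) uniqM
    λ (E∈S , E∈M) → All.lookup S∩𝓤≡∅ E∈S (All.lookup M⊆𝓤 E∈M)
  sizes : All (λ E → ∣ E ∣ ≡ d) (S ++ M)
  sizes = All.++⁺ (reduce⁺ shadow (∣shadow∣≡d uniform) L⊆𝓕₁)
                  (All.map (λ (_ , _ , _ , _ , _ , _ , _ , _ , _ , ∣E∣≡d , _) → ∣E∣≡d) M⊆𝓤)
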